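{- For every integer $r\geq 3$: (1) there exists a $(2r+1)$-regular graph $G$ such that for every maximum matching of $G$, there is a pair of distinct vertices unsaturated with respect to this matching that have a common neighbor in $G$; (2) there exists a graph $H$ with $\Delta(H)=2r+1$ and $\delta(H)=2r$ such that for every maximum matching of $H$, there is a pair of distinct vertices unsaturated with respect to this matching that have a common neighbor in $H$.
   Context: All graphs are finite, undirected and loopless, but may contain multiple edges; the degree of a vertex counts edges with multiplicity. $\Delta(G)$ and $\delta(G)$ denote the maximum and minimum vertex degrees of $G$. A graph is $k$-regular if every vertex has degree $k$. A vertex is unsaturated with respect to a matching $M$ if no edge of $M$ is incident to it. -}

module Defs where

open import Data.Nat using (ℕ; _+_; _*_; _≤_)
open import Data.Fin using (Fin; _≟_)
open import Data.Bool using (if_then_else_; _∨_)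
open import Data.List using (List; length; map; allFin)
open import Data.Nat.ListAction using (sum)
open import Data.List.Membership.Propositional using (_∈_)
open import Data.List.Relation.Unary.Unique.Propositional using (Unique)
open import Data.Product using (Σ; _×_; proj₁; proj₂; ∃-syntax)
open import Data.Sum using (_⊎_)
open import Data.Empty using (⊥)
open import Relation.Nullary using (¬_)
open import Relation.Nullary.Decidable using (⌊_⌋)
open import Relation.Binary.PropositionalEquality using (_≡_; _≢_)

-- A finite loopless multigraph: vertices Fin n, edges indexed by Fin m,
-- each edge having two (distinct) endpoints.  Parallel edges allowed.
record Graph : Set where
  field
    n        : ℕ
    m        : ℕ
    ends     : Fin m → Fin n × Fin n
    loopless : ∀ e → proj₁ (ends e) ≢ proj₂ (ends e)

open Graph public

Incident : (G : Graph) → Fin (n G) → Fin (m G) → Set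
Incident G v e = v ≡ proj₁ (ends G e) ⊎ v ≡ proj₂ (ends G e)

deg : (G : Graph) → Fin (n G) → ℕ
deg G v = sum (map (λ e → if ⌊ v ≟ proj₁ (ends G e) ⌋ ∨ ⌊ v ≟ proj₂ (ends G e) ⌋ then 1 else 0)
                   (allFin (m G)))

Adjacent : (G : Graph) → Fin (n G) → Fin (n G) → Set
Adjacent G u w = ∃[ e ] ((u ≡ proj₁ (ends G e) × w ≡ proj₂ (ends G e))
                        ⊎ (w ≡ proj₁ (ends G e) × u ≡ proj₂ (ends G e)))

Regular : (G : Graph) → ℕ → Set
Regular G k = ∀ v → deg G v ≡ k

MaxDeg≡ : (G : Graph) → ℕ → Set
MaxDeg≡ G k = (∀ v → deg G v ≤ k) × (∃[ v ] deg G v ≡ k)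

MinDeg≡ : (G : Graph) → ℕ → Set
MinDeg≡ G k = (∀ v → k ≤ deg G v) × (∃[ v ] deg G v ≡ k)

IsMatching : (G : Graph) → List (Fin (m G)) → Set
IsMatching G M = Unique M × (∀ e f → e ∈ M → f ∈ M → e ≢ f →
                               ∀ x → Incident G x e → Incident G x f → ⊥)

IsMaximumMatching : (G : Graph) → List (Fin (m G)) → Set
IsMaximumMatching G M = IsMatching G M ×
  (∀ M' → IsMatching G M' → length M' ≤ length M)

Unsaturated : (G : Graph) → List (Fin (m G)) → Fin (n G) → Set
Unsaturated G M v = ¬ (∃[ e ] (e ∈ M × Incident G v e))

BadForAllMaxMatchings : Graph → Set
BadForAllMaxMatchings G = ∀ M → IsMaximumMatching G M →
  ∃[ u ] ∃[ v ] (u ≢ v × Unsaturated G M u × Unsaturated G M v ×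
                 (∃[ w ] (Adjacent G u w × Adjacent G v w)))

module Submission where

-- The graphs live on 24 vertices: hubs x₀, x₁, x₂ and seven triangles with
-- corners t(i,0), t(i,1), t(i,2), corner t(i,k) joined to hub x_k by a spoke.
-- A graph is a list of edge kinds (spokes, triangle sides; repeats allowed).
--
-- Matching argument, valid for EVERY matching of a graph containing all
-- spokes: two distinct sides of a triangle meet, so the three corners of a
-- triangle are never all covered by its own sides.  Hence each triangle has an
-- unsaturated corner t(i,k) or a matched spoke at x_k — one of six labels.  By
-- pigeonhole two of the seven triangles share a label; two matched spokes at
-- one hub are impossible, so t(i,k) ≠ t(j,k) are unsaturated with neighbour x_k.
--
-- Degrees: spokes plus three copies of every side form a 7-regular graph, and
-- deleting one side copy gives degrees 6 and 7; adding q copies of a fixed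
-- 2-factor raises all degrees by 2q, reaching 2r+1 and 2r for r = 3 + q.

open import Defs
open import Data.Nat using (ℕ; zero; suc; _≤_; _+_; _*_; s≤s)
open import Data.Nat.Properties using (+-monoˡ-≤; ≤-refl)
import Data.Nat as ℕ
open import Data.Nat.ListAction using (sum)
open import Data.Nat.ListAction.Properties using (sum-++)
open import Data.Nat.Tactic.RingSolver using (solve-∀)
open import Data.Fin using (Fin; zero; suc; _↑ˡ_; _↑ʳ_; combine; remQuot; splitAt; join; _≟_)
open import Data.Fin.Properties
  using (splitAt-↑ˡ; splitAt-↑ʳ; remQuot-combine; splitAt-join; pigeonhole; <⇒≢; all?)
open import Data.Bool using (if_then_else_; _∨_)
open import Data.List using (List; []; _++_; length; map; lookup; allFin; tabulate;
                             cartesianProductWith; removeAt)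
open import Data.List.Properties using (map-∘; map-tabulate; tabulate-lookup; map-++; ++-assoc)
open import Data.List.Membership.Propositional using (_∈_; find; lose)
open import Data.List.Membership.Propositional.Properties
  using (∈-++⁺ˡ; ∈-allFin; ∈-cartesianProductWith⁺)
open import Data.List.Relation.Unary.Any using (index; any?)
open import Data.List.Relation.Unary.Any.Properties using (lookup-index)
open import Data.Product using (_×_; Σ; _,_; proj₁; proj₂; ∃-syntax)
open import Data.Sum using (_⊎_; inj₁; inj₂)
import Data.Sum as Sum
open import Data.Empty using (⊥; ⊥-elim)
open import Function using (_∘_)
open import Relation.Nullary using (Dec; yes; no)
open import Relation.Nullary.Decidable using (⌊_⌋; from-yes; _⊎-dec_)
open import Relation.Binary.PropositionalEquality
  using (_≡_; _≢_; refl; sym; trans; cong; cong₂; subst₂; module ≡-Reasoning)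

UnsaturatedCherry : (G : Graph) → List (Fin (m G)) → Set
UnsaturatedCherry G M = ∃[ u ] ∃[ v ] (u ≢ v × Unsaturated G M u × Unsaturated G M v ×
                                       (∃[ w ] (Adjacent G u w × Adjacent G v w)))

matched-meet : (G : Graph) (M : List (Fin (m G))) → IsMatching G M →
               ∀ {e f x} → e ∈ M → f ∈ M → Incident G x e → Incident G x f → e ≡ f
matched-meet G M (_ , disjoint) {e} {f} {x} e∈M f∈M x∈e x∈f with e ≟ f
... | yes e≡f = e≡f
... | no  e≢f = ⊥-elim (disjoint e f e∈M f∈M e≢f x x∈e x∈f)

Vertex : Set
Vertex = Fin 24

hub : Fin 3 → Vertex
hub k = k ↑ˡ 21

corner : Fin 7 → Fin 3 → Vertex
corner i k = 3 ↑ʳ combine i k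

decode : Vertex → Fin 3 ⊎ (Fin 7 × Fin 3)
decode v = Sum.map₂ (remQuot {7} 3) (splitAt 3 v)

decode-hub : ∀ k → decode (hub k) ≡ inj₁ k
decode-hub k rewrite splitAt-↑ˡ 3 k 21 = refl

decode-corner : ∀ i k → decode (corner i k) ≡ inj₂ (i , k)
decode-corner i k rewrite splitAt-↑ʳ 3 21 (combine i k) | remQuot-combine {7} {3} i k = refl

corner-injective : ∀ {i k j l} → corner i k ≡ corner j l → i ≡ j × k ≡ l
corner-injective {i} {k} {j} {l} p
  with trans (sym (decode-corner i k)) (trans (cong decode p) (decode-corner j l))
... | refl = refl , refl

corner≢hub : ∀ {i k l} → corner i k ≢ hub l
corner≢hub {i} {k} {l} p with trans (sym (decode-corner i k)) (trans (cong decode p) (decode-hub l))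
... | ()

-- The two corners other than l: the ends of the side opposite corner l.
other₁ other₂ : Fin 3 → Fin 3
other₁ zero             = suc zero
other₁ (suc zero)       = zero
other₁ (suc (suc zero)) = zero
other₂ zero             = suc (suc zero)
other₂ (suc zero)       = suc (suc zero)
other₂ (suc (suc zero)) = suc zero

other₁≢ : ∀ l → other₁ l ≢ l
other₁≢ zero ()
other₁≢ (suc zero) ()
other₁≢ (suc (suc zero)) ()

other₂≢ : ∀ l → other₂ l ≢ l
other₂≢ zero ()
other₂≢ (suc zero) ()
other₂≢ (suc (suc zero)) ()

other₁≢other₂ : ∀ l → other₁ l ≢ other₂ l
other₁≢other₂ zero ()
other₁≢other₂ (suc zero) ()
other₁≢other₂ (suc (suc zero)) ()

side-covers : ∀ l c → c ≢ l → c ≡ other₁ l ⊎ c ≡ other₂ l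
side-covers zero             zero             c≢l = ⊥-elim (c≢l refl)
side-covers zero             (suc zero)       _   = inj₁ refl
side-covers zero             (suc (suc zero)) _   = inj₂ refl
side-covers (suc zero)       zero             _   = inj₁ refl
side-covers (suc zero)       (suc zero)       c≢l = ⊥-elim (c≢l refl)
side-covers (suc zero)       (suc (suc zero)) _   = inj₂ refl
side-covers (suc (suc zero)) zero             _   = inj₁ refl
side-covers (suc (suc zero)) (suc zero)       _   = inj₂ refl
side-covers (suc (suc zero)) (suc (suc zero)) c≢l = ⊥-elim (c≢l refl)

-- Two distinct corners leave a third one; hence two distinct sides meet.
third : ∀ a b → a ≢ b → ∃[ c ] (c ≢ a × c ≢ b)
third a b a≢b with side-covers a b (a≢b ∘ sym)
... | inj₁ b≡o₁ = other₂ a , other₂≢ a , λ c≡b → other₁≢other₂ a (trans (sym b≡o₁) (sym c≡b))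
... | inj₂ b≡o₂ = other₁ a , other₁≢ a , λ c≡b → other₁≢other₂ a (trans c≡b b≡o₂)

no-corner-avoids-all : ∀ (l : Fin 3) → l ≢ zero → l ≢ suc zero → l ≢ suc (suc zero) → ⊥
no-corner-avoids-all zero             l≢0 _ _ = l≢0 refl
no-corner-avoids-all (suc zero)       _ l≢1 _ = l≢1 refl
no-corner-avoids-all (suc (suc zero)) _ _ l≢2 = l≢2 refl

data EdgeKind : Set where
  spoke : Fin 7 → Fin 3 → EdgeKind
  side  : Fin 7 → Fin 3 → EdgeKind   -- side of triangle i opposite corner k

endpoints : EdgeKind → Vertex × Vertex
endpoints (spoke i k) = corner i k , hub k
endpoints (side i l)  = corner i (other₁ l) , corner i (other₂ l)

endpoints-distinct : ∀ κ → proj₁ (endpoints κ) ≢ proj₂ (endpoints κ)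
endpoints-distinct (spoke i k) = corner≢hub {i} {k} {k}
endpoints-distinct (side i l)  = other₁≢other₂ l ∘ proj₂ ∘ corner-injective {i} {other₁ l} {i} {other₂ l}

spoke-injective : ∀ {i k j l} → spoke i k ≡ spoke j l → i ≡ j
spoke-injective refl = refl

side-injective : ∀ {i k j l} → side i k ≡ side j l → k ≡ l
side-injective refl = refl

edgeListGraph : List EdgeKind → Graph
edgeListGraph K = record
  { n = 24 ; m = length K ; ends = endpoints ∘ lookup K ; loopless = endpoints-distinct ∘ lookup K }

meets : Vertex → EdgeKind → ℕ
meets v κ = if ⌊ v ≟ proj₁ (endpoints κ) ⌋ ∨ ⌊ v ≟ proj₂ (endpoints κ) ⌋ then 1 else 0

load : List EdgeKind → Vertex → ℕ
load K v = sum (map (meets v) K)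

deg-edgeListGraph : ∀ K v → deg (edgeListGraph K) v ≡ load K v
deg-edgeListGraph K v = begin
  sum (map (meets v ∘ lookup K) (allFin (length K)))      ≡⟨ cong sum (map-∘ (allFin (length K))) ⟩
  sum (map (meets v) (map (lookup K) (allFin (length K)))) ≡⟨ cong (sum ∘ map (meets v)) lookups ⟩
  load K v                                                 ∎
  where
  open ≡-Reasoning
  -- allFin is tabulate of the identity
  lookups : map (lookup K) (allFin (length K)) ≡ K
  lookups = trans (map-tabulate (λ e → e) (lookup K)) (tabulate-lookup K)

load-++ : ∀ K L v → load (K ++ L) v ≡ load K v + load L v
load-++ K L v = trans (cong sum (map-++ (meets v) K L)) (sum-++ (map (meets v) K) (map (meets v) L))

module SpokeArgument (K : List EdgeKind) (spokes∈K : ∀ i k → spoke i k ∈ K) where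

  G : Graph
  G = edgeListGraph K

  kind : Fin (length K) → EdgeKind
  kind = lookup K

  corner-adj-hub : ∀ i k → Adjacent G (corner i k) (hub k)
  corner-adj-hub i k = index p , inj₁ (cong (proj₁ ∘ endpoints) (lookup-index p) ,
                                       cong (proj₂ ∘ endpoints) (lookup-index p))
    where p = spokes∈K i k

  hub-incident : ∀ {e i k} → kind e ≡ spoke i k → Incident G (hub k) e
  hub-incident eq = inj₂ (cong (proj₂ ∘ endpoints) (sym eq))

  side-incident : ∀ {e i l} c → kind e ≡ side i l → c ≢ l → Incident G (corner i c) e
  side-incident {e} {i} {l} c eq c≢l rewrite eq =
    Sum.map (cong (corner i)) (cong (corner i)) (side-covers l c c≢l)

  incident? : ∀ v e → Dec (Incident G v e)
  incident? v e = (v ≟ proj₁ (ends G e)) ⊎-dec (v ≟ proj₂ (ends G e))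

  module _ (M : List (Fin (length K))) (isMatching : IsMatching G M) where

    data CornerStatus (i : Fin 7) (k : Fin 3) : Set where
      unmatched : Unsaturated G M (corner i k) → CornerStatus i k
      bySpoke   : ∀ e → e ∈ M → kind e ≡ spoke i k → CornerStatus i k
      bySide    : ∀ e → e ∈ M → ∀ l → kind e ≡ side i l → l ≢ k → CornerStatus i k

    classify : ∀ {i k} e → e ∈ M → ∀ κ → kind e ≡ κ →
               corner i k ≡ proj₁ (endpoints κ) ⊎ corner i k ≡ proj₂ (endpoints κ) →
               CornerStatus i k
    classify {i} {k} e e∈M (spoke j l) eq (inj₁ p) with corner-injective {i} {k} {j} {l} p
    ... | refl , refl = bySpoke e e∈M eq
    classify {i} {k} e e∈M (spoke j l) eq (inj₂ p) = ⊥-elim (corner≢hub {i} {k} {l} p)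
    classify {i} {k} e e∈M (side j l) eq (inj₁ p) with corner-injective {i} {k} {j} {other₁ l} p
    ... | refl , refl = bySide e e∈M l eq (other₁≢ l ∘ sym)
    classify {i} {k} e e∈M (side j l) eq (inj₂ p) with corner-injective {i} {k} {j} {other₂ l} p
    ... | refl , refl = bySide e e∈M l eq (other₂≢ l ∘ sym)

    cornerStatus : ∀ i k → CornerStatus i k
    cornerStatus i k with any? (incident? (corner i k)) M
    ... | no ¬covered = unmatched λ (e , e∈M , inc) → ¬covered (lose e∈M inc)
    ... | yes covered = let e , e∈M , inc = find covered in classify e e∈M (kind e) refl inc

    -- Two matched sides of one triangle are the same side (distinct sides meet).
    matched-sides-agree : ∀ {e f i l l'} → e ∈ M → f ∈ M →
                          kind e ≡ side i l → kind f ≡ side i l' → l ≡ l'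
    matched-sides-agree {e} {f} {i} {l} {l'} e∈M f∈M eqe eqf with l ≟ l'
    ... | yes l≡l' = l≡l'
    ... | no  l≢l' =
      let c , c≢l , c≢l' = third l l' l≢l'
          e≡f = matched-meet G M isMatching e∈M f∈M (side-incident c eqe c≢l) (side-incident c eqf c≢l')
      in side-injective (trans (sym eqe) (trans (cong kind e≡f) eqf))

    data TriangleWitness (i : Fin 7) : Set where
      unmatchedCorner : ∀ k → Unsaturated G M (corner i k) → TriangleWitness i
      matchedSpoke    : ∀ k e → e ∈ M → kind e ≡ spoke i k → TriangleWitness i

    triangleWitness : ∀ i → TriangleWitness i
    triangleWitness i = fromStatuses (cornerStatus i zero) (cornerStatus i (suc zero))
                                     (cornerStatus i (suc (suc zero)))
      where
      fromStatuses : CornerStatus i zero → CornerStatus i (suc zero) → CornerStatus i (suc (suc zero)) →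
                     TriangleWitness i
      fromStatuses (unmatched u)     _ _ = unmatchedCorner _ u
      fromStatuses (bySpoke e e∈M p) _ _ = matchedSpoke _ e e∈M p
      fromStatuses _ (unmatched u)     _ = unmatchedCorner _ u
      fromStatuses _ (bySpoke e e∈M p) _ = matchedSpoke _ e e∈M p
      fromStatuses _ _ (unmatched u)     = unmatchedCorner _ u
      fromStatuses _ _ (bySpoke e e∈M p) = matchedSpoke _ e e∈M p
      -- all three corners covered by sides: these sides coincide, yet avoid every corner
      fromStatuses (bySide _ m₀ l₀ p₀ n₀) (bySide _ m₁ _ p₁ n₁) (bySide _ m₂ _ p₂ n₂)
        with matched-sides-agree m₀ m₁ p₀ p₁ | matched-sides-agree m₀ m₂ p₀ p₂
      ... | refl | refl = ⊥-elim (no-corner-avoids-all l₀ n₀ n₁ n₂)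

    label : ∀ {i} → TriangleWitness i → Fin 3 ⊎ Fin 3
    label (unmatchedCorner k _)  = inj₁ k
    label (matchedSpoke k _ _ _) = inj₂ k

    sameLabel : ∀ {i j} → i ≢ j → (a : TriangleWitness i) (b : TriangleWitness j) →
                label a ≡ label b → UnsaturatedCherry G M
    sameLabel {i} {j} i≢j (unmatchedCorner k u) (unmatchedCorner .k u') refl =
      corner i k , corner j k , i≢j ∘ proj₁ ∘ corner-injective , u , u' ,
      hub k , corner-adj-hub i k , corner-adj-hub j k
    sameLabel i≢j (matchedSpoke k e e∈M p) (matchedSpoke .k f f∈M q) refl =
      let e≡f = matched-meet G M isMatching e∈M f∈M (hub-incident p) (hub-incident q)
      in ⊥-elim (i≢j (spoke-injective (trans (sym p) (trans (cong kind e≡f) q))))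

    -- Labels are encoded in Fin 6 for the pigeonhole principle.
    join-injective : ∀ {a b : Fin 3 ⊎ Fin 3} → join 3 3 a ≡ join 3 3 b → a ≡ b
    join-injective {a} {b} eq = trans (sym (splitAt-join 3 3 a)) (trans (cong (splitAt 3) eq) (splitAt-join 3 3 b))

    -- Seven triangles, six labels.
    unsaturatedCherry : UnsaturatedCherry G M
    unsaturatedCherry with pigeonhole (s≤s ≤-refl) (join 3 3 ∘ label ∘ triangleWitness)
    ... | i , j , i<j , eq = sameLabel (<⇒≢ i<j) (triangleWitness i) (triangleWitness j) (join-injective eq)

  badForAllMaxMatchings : BadForAllMaxMatchings G
  badForAllMaxMatchings M (isMatching , _) = unsaturatedCherry M isMatching

spokes triangleSides : List EdgeKind
spokes        = cartesianProductWith spoke (allFin 7) (allFin 3)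
triangleSides = cartesianProductWith side  (allFin 7) (allFin 3)

-- Three copies of every side: together with the spokes, a 7-regular graph.
regularSides : List EdgeKind
regularSides = triangleSides ++ triangleSides ++ triangleSides

-- The same, minus one copy of the side of triangle 0 opposite corner 2.
nearRegularSides : List EdgeKind
nearRegularSides = triangleSides ++ triangleSides ++ removeAt triangleSides (suc (suc zero))

-- A 2-factor: triangles 1–6 and a doubled matching between triangle 0 and the hubs.
twoFactor : List EdgeKind
twoFactor = map (spoke zero) (allFin 3) ++ map (spoke zero) (allFin 3)
            ++ cartesianProductWith side (map suc (allFin 6)) (allFin 3)

padding : ℕ → List EdgeKind
padding zero    = []
padding (suc q) = twoFactor ++ padding q

paddedGraph : List EdgeKind → ℕ → Graph
paddedGraph S q = edgeListGraph (spokes ++ S ++ padding q)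

paddedGraph-bad : ∀ S q → BadForAllMaxMatchings (paddedGraph S q)
paddedGraph-bad S q = SpokeArgument.badForAllMaxMatchings (spokes ++ S ++ padding q) spoke∈
  where
  spoke∈ : ∀ i k → spoke i k ∈ spokes ++ S ++ padding q
  spoke∈ i k = ∈-++⁺ˡ (∈-cartesianProductWith⁺ spoke (∈-allFin i) (∈-allFin k))

twoFactor-load : ∀ v → load twoFactor v ≡ 2
twoFactor-load = from-yes (all? (λ v → load twoFactor v ℕ.≟ 2))

padding-load : ∀ q v → load (padding q) v ≡ q * 2
padding-load zero    v = refl
padding-load (suc q) v = trans (load-++ twoFactor (padding q) v)
                               (cong₂ _+_ (twoFactor-load v) (padding-load q v))

deg-paddedGraph : ∀ S q v → deg (paddedGraph S q) v ≡ load (spokes ++ S) v + q * 2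
deg-paddedGraph S q v = begin
  deg (paddedGraph S q) v                        ≡⟨ deg-edgeListGraph (spokes ++ S ++ padding q) v ⟩
  load (spokes ++ S ++ padding q) v              ≡⟨ cong (λ K → load K v) (sym (++-assoc spokes S (padding q))) ⟩
  load ((spokes ++ S) ++ padding q) v            ≡⟨ load-++ (spokes ++ S) (padding q) v ⟩
  load (spokes ++ S) v + load (padding q) v      ≡⟨ cong (load (spokes ++ S) v +_) (padding-load q v) ⟩
  load (spokes ++ S) v + q * 2                   ∎
  where open ≡-Reasoning

regular-base : ∀ v → load (spokes ++ regularSides) v ≡ 7
regular-base = from-yes (all? (λ v → load (spokes ++ regularSides) v ℕ.≟ 7))

nearRegular-upper : ∀ v → load (spokes ++ nearRegularSides) v ≤ 7
nearRegular-upper = from-yes (all? (λ v → load (spokes ++ nearRegularSides) v ℕ.≤? 7))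

nearRegular-lower : ∀ v → 6 ≤ load (spokes ++ nearRegularSides) v
nearRegular-lower = from-yes (all? (λ v → 6 ℕ.≤? load (spokes ++ nearRegularSides) v))

odd-degree : ∀ q → 7 + q * 2 ≡ 2 * (3 + q) + 1
odd-degree = solve-∀

even-degree : ∀ q → 6 + q * 2 ≡ 2 * (3 + q)
even-degree = solve-∀

regular : ∀ q → Regular (paddedGraph regularSides q) (2 * (3 + q) + 1)
regular q v = trans (deg-paddedGraph regularSides q v)
                    (trans (cong (_+ q * 2) (regular-base v)) (odd-degree q))

nearRegular-max : ∀ q → MaxDeg≡ (paddedGraph nearRegularSides q) (2 * (3 + q) + 1)
nearRegular-max q =
  (λ v → subst₂ _≤_ (sym (deg-paddedGraph nearRegularSides q v)) (odd-degree q)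
                    (+-monoˡ-≤ (q * 2) (nearRegular-upper v))) ,
  hub zero , trans (deg-paddedGraph nearRegularSides q (hub zero)) (odd-degree q)

nearRegular-min : ∀ q → MinDeg≡ (paddedGraph nearRegularSides q) (2 * (3 + q))
nearRegular-min q =
  (λ v → subst₂ _≤_ (even-degree q) (sym (deg-paddedGraph nearRegularSides q v))
                    (+-monoˡ-≤ (q * 2) (nearRegular-lower v))) ,
  corner zero zero , trans (deg-paddedGraph nearRegularSides q (corner zero zero)) (even-degree q)

theorem3 : (r : ℕ) → 3 ≤ r →
    Σ Graph (λ G → Regular G (2 * r + 1) × BadForAllMaxMatchings G)
    × Σ Graph (λ H → MaxDeg≡ H (2 * r + 1) × MinDeg≡ H (2 * r) × BadForAllMaxMatchings H)
theorem3 (suc (suc (suc q))) (s≤s (s≤s (s≤s _))) =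
  (paddedGraph regularSides q , regular q , paddedGraph-bad regularSides q) ,
  (paddedGraph nearRegularSides q , nearRegular-max q , nearRegular-min q ,
   paddedGraph-bad nearRegularSides q)
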